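{- The MTL formula $(\neg a)\,\mathsf{U}\,b$ (with $a,b$ propositional variables and $\mathsf{U}=\mathsf{U}_{\mathbb{Z}}$) is not equivalent to any formula of the unary fragment $\mathrm{TPTL}_{\mathrm{un}}$ of TPTL, given by the grammar $\varphi::=p\mid\neg\varphi\mid x\in I\mid\varphi_1\wedge\varphi_2\mid\mathsf{F}\varphi\mid\mathsf{X}\varphi\mid x.\varphi$.
   Context: Data words: infinite sequences $(P_0,d_0)(P_1,d_1)\dots$ with $P_i\subseteq\mathcal{P}$ (finite set of propositions) and $d_i\in\mathbb{N}$. Intervals are integer intervals with endpoints in $\mathbb{Z}\cup\{\pm\infty\}$. MTL: $(w,i)\models\varphi_1\mathsf{U}_I\varphi_2$ iff there is $j>i$ with $(w,j)\models\varphi_2$, $d_j-d_i\in I$, and $(w,k)\models\varphi_1$ for all $i<k<j$; $(w,i)\models p$ iff $p\in P_i$; $w\models\varphi$ iff $(w,0)\models\varphi$. TPTL: $\varphi::=p\mid x\in I\mid\neg\varphi\mid\varphi_1\wedge\varphi_2\mid\varphi_1\mathsf{U}\varphi_2\mid x.\varphi$; $(w,i,\nu)\models x\in I$ iff $d_i-\nu(x)\in I$; $(w,i,\nu)\models x.\varphi$ iff $(w,i,\nu[x\mapsto d_i])\models\varphi$; $(w,i,\nu)\models\varphi_1\mathsf{U}\varphi_2$ iff there is $j>i$ with $(w,j,\nu)\models\varphi_2$ and $(w,k,\nu)\models\varphi_1$ for all $i<k<j$; $w\models\varphi$ iff $(w,0,\nu_0)\models\varphi$ with $\nu_0$ mapping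 all registers to $d_0$. $\mathsf{F}\varphi:=\mathrm{true}\,\mathsf{U}\,\varphi$ (some strictly later position satisfies $\varphi$), $\mathsf{X}\varphi:=\mathrm{false}\,\mathsf{U}\,\varphi$ (the next position satisfies $\varphi$). Equivalence: same set of satisfying data words. -}

module Defs where

open import Data.Nat using (ℕ; suc; _<_)
open import Data.Integer using (ℤ; +_; _-_) renaming (_≤_ to _≤ℤ_)
open import Data.Maybe using (Maybe; just; nothing)
open import Data.Fin using (Fin)
open import Data.Fin.Subset using (Subset; _∈_)
open import Data.Product using (Σ; _×_; _,_)
open import Data.Unit using (⊤)
open import Relation.Nullary using (¬_)

record Letter (n : ℕ) : Set where
  constructor ⟨_,_⟩
  field
    props : Subset n
    datum : ℕ

open Letter public

DataWord : ℕ → Set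
DataWord n = ℕ → Letter n

-- Integer intervals with endpoints in ℤ ∪ {±∞}
-- (nothing as lower bound = -∞, nothing as upper bound = +∞).
-- Over ℤ every (open/half-open/closed) interval is of this closed form.

record Interval : Set where
  constructor [_,_]
  field
    lower : Maybe ℤ
    upper : Maybe ℤ

AboveLower : Maybe ℤ → ℤ → Set
AboveLower nothing  z = ⊤
AboveLower (just l) z = l ≤ℤ z

BelowUpper : Maybe ℤ → ℤ → Set
BelowUpper nothing  z = ⊤
BelowUpper (just u) z = z ≤ℤ u

_∈I_ : ℤ → Interval → Set
z ∈I [ l , u ] = AboveLower l z × BelowUpper u z

ℤ-interval : Interval
ℤ-interval = [ nothing , nothing ]

diff : ℕ → ℕ → ℤ
diff a b = (+ a) - (+ b)

data MTL (n : ℕ) : Set where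
  prop  : Fin n → MTL n
  ¬ₘ_   : MTL n → MTL n
  _∧ₘ_  : MTL n → MTL n → MTL n
  _U[_]_ : MTL n → Interval → MTL n → MTL n

Satₘ : ∀ {n} → DataWord n → ℕ → MTL n → Set
Satₘ w i (prop p) = p ∈ props (w i)
Satₘ w i (¬ₘ φ) = ¬ (Satₘ w i φ)
Satₘ w i (φ ∧ₘ ψ) = (Satₘ w i φ) × (Satₘ w i ψ)
Satₘ w i (φ U[ I ] ψ) =
  Σ ℕ λ j → (i < j) × (Satₘ w j ψ) × (diff (datum (w j)) (datum (w i)) ∈I I)
          × (∀ k → i < k → k < j → Satₘ w k φ)

_⊨ₘ_ : ∀ {n} → DataWord n → MTL n → Set
w ⊨ₘ φ = Satₘ w 0 φ

-- Unary fragment TPTL_un of TPTL (registers are natural numbers).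
-- F and X are primitives here, with the semantics of their TPTL
-- abbreviations  F φ = true U φ,  X φ = false U φ.

Register : Set
Register = ℕ

data TPTLun (n : ℕ) : Set where
  prop  : Fin n → TPTLun n
  ¬ₜ_   : TPTLun n → TPTLun n
  _∈ₜ_  : Register → Interval → TPTLun n
  _∧ₜ_  : TPTLun n → TPTLun n → TPTLun n
  Fₜ    : TPTLun n → TPTLun n
  Xₜ    : TPTLun n → TPTLun n
  bind  : Register → TPTLun n → TPTLun n

Valuation : Set
Valuation = Register → ℕ

update : Valuation → Register → ℕ → Valuation
update ν x d y with Data.Nat._≟_ x y
... | Relation.Nullary.yes _ = d
... | Relation.Nullary.no  _ = ν y

Satₜ : ∀ {n} → DataWord n → ℕ → Valuation → TPTLun n → Set
Satₜ w i ν (prop p) = p ∈ props (w i)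
Satₜ w i ν (¬ₜ φ) = ¬ (Satₜ w i ν φ)
Satₜ w i ν (x ∈ₜ I) = diff (datum (w i)) (ν x) ∈I I
Satₜ w i ν (φ ∧ₜ ψ) = (Satₜ w i ν φ) × (Satₜ w i ν ψ)
Satₜ w i ν (Fₜ φ) = Σ ℕ λ j → (i < j) × (Satₜ w j ν φ)
Satₜ w i ν (Xₜ φ) = Satₜ w (suc i) ν φ
Satₜ w i ν (bind x φ) = Satₜ w i (update ν x (datum (w i))) φ

_⊨ₜ_ : ∀ {n} → DataWord n → TPTLun n → Set
w ⊨ₜ φ = Satₜ w 0 (λ _ → datum (w 0)) φ

Equivalent : ∀ {n} → MTL n → TPTLun n → Set
Equivalent ψ φ = ∀ w → (w ⊨ₘ ψ → w ⊨ₜ φ) × (w ⊨ₜ φ → w ⊨ₘ ψ)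

notAUntilB : ∀ {n} → Fin n → Fin n → MTL n
notAUntilB a b = (¬ₘ prop a) U[ ℤ-interval ] prop b

-- Take N at least the nesting depth of X in φ, all data 0, and the words
--   u = ∅ (∅ᴺ b ∅ᴺ a)^ω   and   v = ∅ (∅ᴺ a ∅ᴺ b)^ω.
-- They agree on positions 0..N, which is all that X can inspect, and each
-- suffix of one starting after position i also starts after position i in
-- the other, which is all that F can ask for.  Hence φ cannot separate u
-- from v, although u ⊨ (¬a) U b and v ⊭ (¬a) U b.
module Submission where

open import Defs
open import Data.Nat using (ℕ; NonZero; zero; suc; _+_; _≤_; _<_; _⊔_; z≤n; s≤s; z<s; _≟_)
open import Data.Nat.Properties
open import Data.Nat.DivMod using (_%_; %-distribˡ-+; n%n≡0; m<n⇒m%n≡m)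
open import Data.Fin using (Fin)
open import Data.Fin.Subset using (Subset; ⁅_⁆; ⊥; _∈_)
open import Data.Fin.Subset.Properties using (x∈⁅x⁆; x∈⁅y⁆⇒x≡y; ∉⊥)
open import Data.Product using (Σ; _×_; _,_; proj₁; proj₂)
open import Data.Unit using (tt)
open import Relation.Nullary using (¬_; yes; no; contradiction)
open import Relation.Binary using (tri<; tri≈; tri>)
open import Relation.Binary.PropositionalEquality
open ≡-Reasoning

%-congˡ-+ : ∀ a b t d .{{_ : NonZero d}} →
            a % d ≡ b % d → (a + t) % d ≡ (b + t) % d
%-congˡ-+ a b t d a≡b = begin
  (a + t) % d                ≡⟨ %-distribˡ-+ a t d ⟩
  (a % d + t % d) % d        ≡⟨ cong (λ r → (r + t % d) % d) a≡b ⟩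
  (b % d + t % d) % d        ≡⟨ %-distribˡ-+ b t d ⟨
  (b + t) % d                ∎

nextDepth : ∀ {n} → TPTLun n → ℕ
nextDepth (prop p)   = 0
nextDepth (¬ₜ φ)     = nextDepth φ
nextDepth (x ∈ₜ I)   = 0
nextDepth (φ ∧ₜ ψ)   = nextDepth φ ⊔ nextDepth ψ
nextDepth (Fₜ φ)     = 0
nextDepth (Xₜ φ)     = suc (nextDepth φ)
nextDepth (bind x φ) = nextDepth φ

module _ {n : ℕ} where

  record SameSuffix (w : DataWord n) (j : ℕ) (w' : DataWord n) (j' : ℕ) : Set where
    constructor sameSuffix
    field
      suffix-≡ : ∀ t → w (j + t) ≡ w' (j' + t)

  open SameSuffix

  module _ {w w' : DataWord n} {j j' : ℕ} where

    SameSuffix-sym : SameSuffix w j w' j' → SameSuffix w' j' w j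
    SameSuffix-sym same = sameSuffix λ t → sym (suffix-≡ same t)

    SameSuffix-head : SameSuffix w j w' j' → w j ≡ w' j'
    SameSuffix-head same = begin
      w j         ≡⟨ cong w (+-identityʳ j) ⟨
      w (j + 0)   ≡⟨ suffix-≡ same 0 ⟩
      w' (j' + 0) ≡⟨ cong w' (+-identityʳ j') ⟩
      w' j'       ∎

    SameSuffix-suc : SameSuffix w j w' j' → SameSuffix w (suc j) w' (suc j')
    SameSuffix-suc same = sameSuffix λ t → begin
      w (suc (j + t))    ≡⟨ cong w (+-suc j t) ⟨
      w (j + suc t)      ≡⟨ suffix-≡ same (suc t) ⟩
      w' (j' + suc t)    ≡⟨ cong w' (+-suc j' t) ⟩
      w' (suc (j' + t))  ∎

    SameSuffix-drop : ∀ k → SameSuffix w j w' j' → SameSuffix w (j + k) w' (j' + k)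
    SameSuffix-drop k same = sameSuffix λ t → begin
      w (j + k + t)      ≡⟨ cong w (+-assoc j k t) ⟩
      w (j + (k + t))    ≡⟨ suffix-≡ same (k + t) ⟩
      w' (j' + (k + t))  ≡⟨ cong w' (+-assoc j' k t) ⟨
      w' (j' + k + t)    ∎

  Satₜ-sameSuffix : ∀ φ {w w' j j' ν} → SameSuffix w j w' j' →
                    Satₜ w j ν φ → Satₜ w' j' ν φ
  Satₜ-sameSuffix (prop p) same = subst (λ l → p ∈ props l) (SameSuffix-head same)
  Satₜ-sameSuffix (¬ₜ φ) same ¬s s' = ¬s (Satₜ-sameSuffix φ (SameSuffix-sym same) s')
  Satₜ-sameSuffix (x ∈ₜ I) {ν = ν} same =
    subst (λ l → diff (datum l) (ν x) ∈I I) (SameSuffix-head same)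
  Satₜ-sameSuffix (φ ∧ₜ ψ) same (s , r) = Satₜ-sameSuffix φ same s , Satₜ-sameSuffix ψ same r
  Satₜ-sameSuffix (Fₜ φ) {j' = j'} same (m , j<m , s) with m≤n⇒∃[o]m+o≡n j<m
  ... | k , refl =
    suc (j' + k) , s≤s (m≤m+n j' k) , Satₜ-sameSuffix φ (SameSuffix-suc (SameSuffix-drop k same)) s
  Satₜ-sameSuffix (Xₜ φ) same = Satₜ-sameSuffix φ (SameSuffix-suc same)
  Satₜ-sameSuffix (bind x φ) {w' = w'} {j' = j'} {ν} same s =
    subst (λ l → Satₜ w' j' (update ν x (datum l)) φ) (SameSuffix-head same)
          (Satₜ-sameSuffix φ same s)

  SuffixesRecur : DataWord n → DataWord n → Set
  SuffixesRecur u v = ∀ {i j} → i < j → Σ ℕ λ j' → i < j' × SameSuffix u j v j'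

  record Similar (N : ℕ) (u v : DataWord n) : Set where
    field
      prefix : ∀ {i} → i ≤ N → u i ≡ v i
      forth  : SuffixesRecur u v
      back   : SuffixesRecur v u

  open Similar

  Similar-sym : ∀ {N u v} → Similar N u v → Similar N v u
  Similar-sym sim = record
    { prefix = λ i≤N → sym (prefix sim i≤N) ; forth = back sim ; back = forth sim }

  Similar⇒Satₜ : ∀ {N u v} → Similar N u v → ∀ φ {i ν} → i + nextDepth φ ≤ N →
                 Satₜ u i ν φ → Satₜ v i ν φ
  Similar⇒Satₜ sim (prop p) {i} le =
    subst (λ l → p ∈ props l) (prefix sim (m+n≤o⇒m≤o i le))
  Similar⇒Satₜ sim (¬ₜ φ) le ¬s s' = ¬s (Similar⇒Satₜ (Similar-sym sim) φ le s')
  Similar⇒Satₜ sim (x ∈ₜ I) {i} {ν} le =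
    subst (λ l → diff (datum l) (ν x) ∈I I) (prefix sim (m+n≤o⇒m≤o i le))
  Similar⇒Satₜ sim (φ ∧ₜ ψ) {i} le (s , r) =
    Similar⇒Satₜ sim φ (≤-trans (+-monoʳ-≤ i (m≤m⊔n _ _)) le) s ,
    Similar⇒Satₜ sim ψ (≤-trans (+-monoʳ-≤ i (m≤n⊔m _ _)) le) r
  Similar⇒Satₜ sim (Fₜ φ) le (j , i<j , s) with forth sim i<j
  ... | j' , i<j' , same = j' , i<j' , Satₜ-sameSuffix φ same s
  Similar⇒Satₜ {N} sim (Xₜ φ) {i} le = Similar⇒Satₜ sim φ (subst (_≤ N) (+-suc i _) le)
  Similar⇒Satₜ {v = v} sim (bind x φ) {i} {ν} le s =
    subst (λ l → Satₜ v i (update ν x (datum l)) φ) (prefix sim (m+n≤o⇒m≤o i le))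
          (Similar⇒Satₜ sim φ le s)

  Similar⇒⊨ₜ : ∀ {u v} φ → Similar (nextDepth φ) u v → u ⊨ₜ φ → v ⊨ₜ φ
  Similar⇒⊨ₜ {v = v} φ sim s =
    subst (λ l → Satₜ v 0 (λ _ → datum l) φ) (prefix sim z≤n)
          (Similar⇒Satₜ sim φ ≤-refl s)

module Witnesses {n : ℕ} (a b : Fin n) (N : ℕ) where

  period : ℕ
  period = suc N + suc N

  marker : ℕ → Subset n
  marker r with r ≟ N | r ≟ suc N + N
  ... | yes _ | _     = ⁅ b ⁆
  ... | no _  | yes _ = ⁅ a ⁆
  ... | no _  | no _  = ⊥

  marker-b : marker N ≡ ⁅ b ⁆
  marker-b with N ≟ N | N ≟ suc N + N
  ... | yes _  | _ = refl
  ... | no N≢N | _ = contradiction refl N≢N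

  marker-a : marker (suc N + N) ≡ ⁅ a ⁆
  marker-a with suc N + N ≟ N | suc N + N ≟ suc N + N
  ... | yes eq | _       = contradiction (sym eq) (m≢1+m+n N)
  ... | no _   | yes _   = refl
  ... | no _   | no r≢r  = contradiction refl r≢r

  marker-blank : ∀ {r} → r ≢ N → r ≢ suc N + N → marker r ≡ ⊥
  marker-blank {r} r≢N r≢a with r ≟ N | r ≟ suc N + N
  ... | yes eq | _      = contradiction eq r≢N
  ... | no _   | yes eq = contradiction eq r≢a
  ... | no _   | no _   = refl

  phased : ℕ → DataWord n
  phased s zero    = ⟨ ⊥ , 0 ⟩
  phased s (suc t) = ⟨ marker ((s + t) % period) , 0 ⟩

  u v : DataWord n
  u = phased 0
  v = phased (suc N)

  phased-sameSuffix : ∀ {s s' j j'} → (s + j) % period ≡ (s' + j') % period →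
                      SameSuffix (phased s) (suc j) (phased s') (suc j')
  phased-sameSuffix {s} {s'} {j} {j'} eq = sameSuffix λ t → cong (λ r → ⟨ marker r , 0 ⟩) (begin
    (s + (j + t)) % period    ≡⟨ cong (_% period) (+-assoc s j t) ⟨
    (s + j + t) % period      ≡⟨ %-congˡ-+ (s + j) (s' + j') t period eq ⟩
    (s' + j' + t) % period    ≡⟨ cong (_% period) (+-assoc s' j' t) ⟩
    (s' + (j' + t)) % period  ∎)

  phased-recur : ∀ {s s'} → s % period ≡ (s' + suc N) % period →
                 SuffixesRecur (phased s) (phased s')
  phased-recur {s} {s'} eq {j = suc j} i<j =
    suc (j + suc N) , ≤-trans i<j (s≤s (m≤m+n j (suc N))) , phased-sameSuffix (begin
      (s + j) % period              ≡⟨ %-congˡ-+ s (s' + suc N) j period eq ⟩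
      (s' + suc N + j) % period     ≡⟨ cong (_% period) (+-assoc s' (suc N) j) ⟩
      (s' + (suc N + j)) % period   ≡⟨ cong (λ r → (s' + r) % period) (+-comm (suc N) j) ⟩
      (s' + (j + suc N)) % period   ∎)

  N<period : N < period
  N<period = s≤s (m≤m+n N (suc N))

  u-blank : ∀ {t} → t < N → u (suc t) ≡ ⟨ ⊥ , 0 ⟩
  u-blank {t} t<N = cong (λ r → ⟨ r , 0 ⟩) (begin
    marker (t % period) ≡⟨ cong marker (m<n⇒m%n≡m (<-trans t<N N<period)) ⟩
    marker t            ≡⟨ marker-blank (<⇒≢ t<N) (<⇒≢ (<-trans t<N (s≤s (m≤m+n N N)))) ⟩
    ⊥                   ∎)

  v-blank : ∀ {t} → t < N → v (suc t) ≡ ⟨ ⊥ , 0 ⟩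
  v-blank {t} t<N = cong (λ r → ⟨ r , 0 ⟩) (begin
    marker ((suc N + t) % period) ≡⟨ cong marker (m<n⇒m%n≡m (+-monoʳ-< (suc N) (m<n⇒m<1+n t<N))) ⟩
    marker (suc N + t)            ≡⟨ marker-blank (≢-sym (<⇒≢ (s≤s (m≤m+n N t))))
                                                  (<⇒≢ (+-monoʳ-< (suc N) t<N)) ⟩
    ⊥                             ∎)

  u-b : props (u (suc N)) ≡ ⁅ b ⁆
  u-b = trans (cong marker (m<n⇒m%n≡m N<period)) marker-b

  v-a : props (v (suc N)) ≡ ⁅ a ⁆
  v-a = trans (cong marker (m<n⇒m%n≡m (+-monoʳ-< (suc N) (n<1+n N)))) marker-a

  similar : Similar N u v
  similar = record
    { prefix = prefix
    ; forth  = phased-recur (sym (n%n≡0 period))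
    ; back   = phased-recur refl
    }
    where
    prefix : ∀ {i} → i ≤ N → u i ≡ v i
    prefix {zero}  _         = refl
    prefix {suc t} t<N       = trans (u-blank t<N) (sym (v-blank t<N))

  u-sat : u ⊨ₘ notAUntilB a b
  u-sat = suc N , z<s , subst (b ∈_) (sym u-b) (x∈⁅x⁆ b) , (tt , tt) , ¬a-before
    where
    ¬a-before : ∀ k → 0 < k → k < suc N → ¬ (a ∈ props (u k))
    ¬a-before (suc t) _ (s≤s t<N) a∈ = ∉⊥ (subst (λ l → a ∈ props l) (u-blank t<N) a∈)

  v-unsat : a ≢ b → ¬ (v ⊨ₘ notAUntilB a b)
  v-unsat a≢b (suc t , _ , b∈ , _ , ¬a-before) with <-cmp t N
  ... | tri< t<N _ _ = ∉⊥ (subst (λ l → b ∈ props l) (v-blank t<N) b∈)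
  ... | tri≈ _ refl _ = a≢b (sym (x∈⁅y⁆⇒x≡y a (subst (b ∈_) v-a b∈)))
  ... | tri> _ _ N<t = ¬a-before (suc N) z<s (s≤s N<t) (subst (a ∈_) (sym v-a) (x∈⁅x⁆ a))

proposition7 : (n : ℕ) (a b : Fin n) → a ≢ b →
    ¬ (Σ (TPTLun n) λ φ → Equivalent (notAUntilB a b) φ)
proposition7 n a b a≢b (φ , equivalent) =
  v-unsat a≢b (proj₂ (equivalent v) (Similar⇒⊨ₜ φ similar (proj₁ (equivalent u) u-sat)))
  where open Witnesses a b (nextDepth φ)
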